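{- Let $S$ be a string of length $n$ over an alphabet $\Sigma$, let $Q \subseteq \Sigma$ with $|Q|\ge 2$, and let $t_1$ be the smallest right endpoint of a minimal co-occurrence of $Q$ in $S$ (with $t_1=n+1$ if there is none). Then for every integer $w$ with $1\le w\le n$, \[\mathsf{co}(w) = \left(\sum_{i=2}^w \mathsf{lmco}(i)\right) - \max(w - t_1,0).\]
   Context: An interval $[i,j]\subseteq[1,n]$ is a co-occurrence of $Q$ in $S$ if $S[i..j]$ contains each character of $Q$ at least once; it is left-minimal if $[i+1,j]$ is not a co-occurrence, and minimal if neither $[i+1,j]$ nor $[i,j-1]$ is a co-occurrence. $\mathsf{co}(w)$ is the number of co-occurrences of length $w$ (equivalently, the number of $k\in[w,n]$ such that $[k-w+1,k]$ is a co-occurrence), and $\mathsf{lmco}(w)$ is the number of left-minimal co-occurrences of length $w$, where the length of $[i,j]$ is $j-i+1$. -}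

module Defs where

open import Data.Nat using (ℕ; zero; suc; _+_; _∸_; _≤_; _≤?_)
open import Data.List using (List; []; _∷_; length; map; upTo; filter)
open import Data.List.Relation.Unary.Any using (Any; any?)
open import Data.List.Relation.Unary.All using (All; all?)
open import Data.Maybe using (Maybe; just; nothing)
import Data.Maybe.Properties as MaybeP
open import Data.Product using (_×_)
open import Relation.Nullary using (Dec; yes; no; ¬_)
open import Relation.Nullary.Decidable using (_×-dec_; ¬?)
open import Relation.Binary.PropositionalEquality using (_≡_)
open import Relation.Binary.Definitions using (DecidableEquality)

-- 1-based character access: charAt S k = S[k] for 1 ≤ k ≤ |S|, nothing otherwise.
charAt : {A : Set} → List A → ℕ → Maybe A
charAt []       _             = nothing
charAt (x ∷ xs) zero          = nothing
charAt (x ∷ xs) (suc zero)    = just x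
charAt (x ∷ xs) (suc (suc k)) = charAt xs (suc k)

-- the list [i, i+1, ..., j]  (empty if j < i)
range : ℕ → ℕ → List ℕ
range i j = map (i +_) (upTo (suc j ∸ i))

count : {A : Set} {P : A → Set} → ((x : A) → Dec (P x)) → List A → ℕ
count P? xs = length (filter P? xs)

module _ {A : Set} (_≟_ : DecidableEquality A) (S : List A) (Q : List A) where

  n : ℕ
  n = length S

  Contains : ℕ → ℕ → A → Set
  Contains i j q = Any (λ k → charAt S k ≡ just q) (range i j)

  IsCo : ℕ → ℕ → Set
  IsCo i j = (1 ≤ i) × (i ≤ j) × (j ≤ n) × All (Contains i j) Q

  IsLeftMinCo : ℕ → ℕ → Set
  IsLeftMinCo i j = IsCo i j × ¬ IsCo (suc i) j

  IsMinCo : ℕ → ℕ → Set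
  IsMinCo i j = IsCo i j × ¬ IsCo (suc i) j × ¬ IsCo i (j ∸ 1)

  contains? : ∀ i j q → Dec (Contains i j q)
  contains? i j q = any? (λ k → MaybeP.≡-dec _≟_ (charAt S k) (just q)) (range i j)

  isCo? : ∀ i j → Dec (IsCo i j)
  isCo? i j = (1 ≤? i) ×-dec (i ≤? j) ×-dec (j ≤? n) ×-dec all? (contains? i j) Q

  isLeftMinCo? : ∀ i j → Dec (IsLeftMinCo i j)
  isLeftMinCo? i j = isCo? i j ×-dec ¬? (isCo? (suc i) j)

  isMinCo? : ∀ i j → Dec (IsMinCo i j)
  isMinCo? i j = isCo? i j ×-dec ¬? (isCo? (suc i) j) ×-dec ¬? (isCo? i (j ∸ 1))

  co : ℕ → ℕ
  co w = count (λ k → isCo? (suc k ∸ w) k) (range w n)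

  -- lmco(w): number of left-minimal co-occurrences of length w
  -- (intervals of length w in [1,n] are exactly [k-w+1,k] for k ∈ [w,n])
  lmco : ℕ → ℕ
  lmco w = count (λ k → isLeftMinCo? (suc k ∸ w) k) (range w n)

  IsMinCoEnd : ℕ → Set
  IsMinCoEnd j = Any (λ i → IsMinCo i j) (range 1 j)

  isMinCoEnd? : ∀ j → Dec (IsMinCoEnd j)
  isMinCoEnd? j = any? (λ i → isMinCo? i j) (range 1 j)

  firstOr : ℕ → List ℕ → ℕ
  firstOr d [] = d
  firstOr d (x ∷ xs) with isMinCoEnd? x
  ... | yes _ = x
  ... | no  _ = firstOr d xs

  t₁ : ℕ
  t₁ = firstOr (suc n) (range 1 n)

-- Write Co(i, j) for "[i, j] is a co-occurrence". Extending an interval to the left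
-- preserves Co, so the window [k - w, k] is left-minimal exactly when Co(k - w, k) holds
-- and Co(k - w + 1, k) fails. Hence the windows of length w + 1 are the left-minimal ones
-- together with those whose shortening on the left is a co-occurrence; the latter
-- correspond to the windows of length w other than [1, w], so
-- co(w + 1) = lmco(w + 1) + co(w) - [Co(1, w)]. Moreover Co(1, w) holds iff t₁ ≤ w,
-- because the least j with Co(1, j) ends a minimal co-occurrence. Summing up from
-- co(1) = 0 (no single position holds two distinct letters of Q) gives the formula.
module Submission where

open import Defs
open import Data.Nat using (ℕ; zero; suc; _+_; _∸_; _≤_; _<_; z≤n; s≤s; s≤s⁻¹)
open import Data.Nat.Properties
open import Data.Nat.ListAction using (sum)
open import Data.Nat.ListAction.Properties using (sum-++)
open import Data.List using (List; []; _∷_; _∷ʳ_; _++_; length; map; upTo; applyUpTo)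
open import Data.List.Properties
  using (map-++; map-∘; map-cong; map-upTo; upTo-∷ʳ; filter-accept; filter-reject; filter-none)
open import Data.List.Membership.Propositional using (_∈_; find; lose)
open import Data.List.Membership.Propositional.Properties using (∈-map⁺; ∈-map⁻; ∈-upTo⁺; ∈-upTo⁻)
open import Data.List.Relation.Unary.Any using (here; there)
open import Data.List.Relation.Unary.All as All using (All; []; _∷_)
open import Data.List.Relation.Unary.AllPairs using (AllPairs; []; _∷_)
import Data.List.Relation.Unary.AllPairs.Properties as AllPairs
open import Data.List.Relation.Unary.Unique.Propositional using (Unique)
open import Data.Maybe using (just)
open import Data.Maybe.Properties using (just-injective)
open import Data.Product using (_×_; _,_; proj₁; ∃-syntax)
open import Data.Sum using (_⊎_; inj₁; inj₂)
open import Function using (_∘_; case_of_)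
open import Relation.Nullary using (Dec; yes; no; ¬_; contradiction)
open import Relation.Nullary.Decidable using (_×-dec_; ¬?)
open import Relation.Unary using (Decidable)
open import Relation.Binary.PropositionalEquality
open import Relation.Binary.Definitions using (DecidableEquality)
open ≡-Reasoning

module _ {B : Set} {P : B → Set} (P? : Decidable P) where

  count-accept : ∀ {x xs} → P x → count P? (x ∷ xs) ≡ suc (count P? xs)
  count-accept p = cong length (filter-accept P? p)

  count-reject : ∀ {x xs} → ¬ P x → count P? (x ∷ xs) ≡ count P? xs
  count-reject ¬p = cong length (filter-reject P? ¬p)

  count-none : ∀ {xs} → All (¬_ ∘ P) xs → count P? xs ≡ 0
  count-none ¬ps = cong length (filter-none P? ¬ps)

module _ {B : Set} {P Q : B → Set} (P? : Decidable P) (Q? : Decidable Q) where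

  count-cong : ∀ {xs} → All (λ x → (P x → Q x) × (Q x → P x)) xs → count P? xs ≡ count Q? xs
  count-cong [] = refl
  count-cong {x ∷ xs} ((p⇒q , q⇒p) ∷ eqs) = case P? x of λ where
    (yes p) → begin
      count P? (x ∷ xs)    ≡⟨ count-accept P? p ⟩
      suc (count P? xs)    ≡⟨ cong suc (count-cong eqs) ⟩
      suc (count Q? xs)    ≡⟨ count-accept Q? (p⇒q p) ⟨
      count Q? (x ∷ xs)    ∎
    (no ¬p) → begin
      count P? (x ∷ xs)    ≡⟨ count-reject P? ¬p ⟩
      count P? xs          ≡⟨ count-cong eqs ⟩
      count Q? xs          ≡⟨ count-reject Q? (¬p ∘ q⇒p) ⟨
      count Q? (x ∷ xs)    ∎

  P∖Q? : Decidable (λ x → P x × ¬ Q x)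
  P∖Q? x = P? x ×-dec ¬? (Q? x)

  count-split : ∀ {xs} → All (λ x → Q x → P x) xs → count P? xs ≡ count P∖Q? xs + count Q? xs
  count-split [] = refl
  count-split {x ∷ xs} (q⇒p ∷ q⇒ps) = case Q? x of λ where
    (yes q) → begin
      count P? (x ∷ xs)                        ≡⟨ count-accept P? (q⇒p q) ⟩
      suc (count P? xs)                        ≡⟨ cong suc (count-split q⇒ps) ⟩
      suc (count P∖Q? xs + count Q? xs)        ≡⟨ +-suc _ _ ⟨
      count P∖Q? xs + suc (count Q? xs)        ≡⟨ cong₂ _+_ (count-reject P∖Q? (λ (_ , ¬q) → ¬q q)) (count-accept Q? q) ⟨
      count P∖Q? (x ∷ xs) + count Q? (x ∷ xs)  ∎
    (no ¬q) → case P? x of λ where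
      (yes p) → begin
        count P? (x ∷ xs)                        ≡⟨ count-accept P? p ⟩
        suc (count P? xs)                        ≡⟨ cong suc (count-split q⇒ps) ⟩
        suc (count P∖Q? xs + count Q? xs)        ≡⟨ cong₂ _+_ (count-accept P∖Q? (p , ¬q)) (count-reject Q? ¬q) ⟨
        count P∖Q? (x ∷ xs) + count Q? (x ∷ xs)  ∎
      (no ¬p) → begin
        count P? (x ∷ xs)                        ≡⟨ count-reject P? ¬p ⟩
        count P? xs                              ≡⟨ count-split q⇒ps ⟩
        count P∖Q? xs + count Q? xs              ≡⟨ cong₂ _+_ (count-reject P∖Q? (¬p ∘ proj₁)) (count-reject Q? ¬q) ⟨
        count P∖Q? (x ∷ xs) + count Q? (x ∷ xs)  ∎

sum-map-∷ʳ : ∀ (f : ℕ → ℕ) xs x → sum (map f (xs ∷ʳ x)) ≡ sum (map f xs) + f x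
sum-map-∷ʳ f xs x = begin
  sum (map f (xs ∷ʳ x))          ≡⟨ cong sum (map-++ f xs (x ∷ [])) ⟩
  sum (map f xs ++ f x ∷ [])     ≡⟨ sum-++ (map f xs) (f x ∷ []) ⟩
  sum (map f xs) + (f x + 0)     ≡⟨ cong₂ _+_ refl (+-identityʳ (f x)) ⟩
  sum (map f xs) + f x           ∎

∃-boundary : ∀ {P : ℕ → Set} → Decidable P → ∀ k {i} → P i → ¬ P (k + i) → ∃[ m ] (P m × ¬ P (suc m))
∃-boundary P? zero p ¬p = contradiction p ¬p
∃-boundary {P} P? (suc k) {i} p ¬p = case P? (suc i) of λ where
  (yes p′) → ∃-boundary P? k p′ (¬p ∘ subst P (+-suc k i))
  (no ¬p′) → i , p , ¬p′

range-∷ : ∀ {i j} → i ≤ j → range i j ≡ i ∷ range (suc i) j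
range-∷ {i} {j} i≤j = begin
  map (i +_) (upTo (suc j ∸ i))                 ≡⟨ cong (map (i +_) ∘ upTo) (+-∸-assoc 1 i≤j) ⟩
  i + 0 ∷ map (i +_) (applyUpTo suc (j ∸ i))    ≡⟨ cong₂ _∷_ (+-identityʳ i) shifted ⟩
  i ∷ map (suc i +_) (upTo (j ∸ i))             ∎
  where
  shifted : map (i +_) (applyUpTo suc (j ∸ i)) ≡ map (suc i +_) (upTo (j ∸ i))
  shifted = begin
    map (i +_) (applyUpTo suc (j ∸ i))          ≡⟨ cong (map (i +_)) (map-upTo suc (j ∸ i)) ⟨
    map (i +_) (map suc (upTo (j ∸ i)))         ≡⟨ map-∘ (upTo (j ∸ i)) ⟨
    map ((i +_) ∘ suc) (upTo (j ∸ i))           ≡⟨ map-cong (+-suc i) (upTo (j ∸ i)) ⟩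
    map (suc i +_) (upTo (j ∸ i))               ∎

range-∷ʳ : ∀ {i j} → i ≤ suc j → range i (suc j) ≡ range i j ∷ʳ suc j
range-∷ʳ {i} {j} i≤1+j = begin
  map (i +_) (upTo (suc (suc j) ∸ i))           ≡⟨ cong (map (i +_) ∘ upTo) (+-∸-assoc 1 i≤1+j) ⟩
  map (i +_) (upTo (suc (suc j ∸ i)))           ≡⟨ cong (map (i +_)) (upTo-∷ʳ (suc j ∸ i)) ⟨
  map (i +_) (upTo (suc j ∸ i) ∷ʳ (suc j ∸ i))  ≡⟨ map-++ (i +_) (upTo (suc j ∸ i)) _ ⟩
  range i j ∷ʳ (i + (suc j ∸ i))                ≡⟨ cong (range i j ∷ʳ_) (m+[n∸m]≡n i≤1+j) ⟩
  range i j ∷ʳ suc j                            ∎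

∈-range⁺ : ∀ {i j x} → i ≤ x → x ≤ j → x ∈ range i j
∈-range⁺ {i} {j} i≤x x≤j =
  subst (_∈ range i j) (m+[n∸m]≡n i≤x) (∈-map⁺ (i +_) (∈-upTo⁺ (∸-monoˡ-< (s≤s x≤j) i≤x)))

∈-range⁻ : ∀ {i j x} → x ∈ range i j → i ≤ x × x ≤ j
∈-range⁻ {i} {j} x∈ with y , y∈ , refl ← ∈-map⁻ (i +_) x∈ = m≤m+n i y , i+y≤j
  where
  y<1+j∸i = ∈-upTo⁻ y∈
  i<1+j : i < suc j
  i<1+j = m∸n≢0⇒n<m (λ 1+j∸i≡0 → n≮0 (subst (y <_) 1+j∸i≡0 y<1+j∸i))
  i+y≤j : i + y ≤ j
  i+y≤j = subst (_≤ j) (+-comm y i) (s≤s⁻¹ (m≤o∸n⇒m+n≤o (suc y) (<⇒≤ i<1+j) y<1+j∸i))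

range-increasing : ∀ i j → AllPairs _<_ (range i j)
range-increasing i j = AllPairs.map⁺ (AllPairs.applyUpTo⁺₁ _ _ (λ x<y _ → +-monoʳ-< i x<y))

module _ {A : Set} (_≟_ : DecidableEquality A) (S Q : List A) where
  private
    Co : ℕ → ℕ → Set
    Co = IsCo _≟_ S Q

    co? : ∀ i j → Dec (Co i j)
    co? = isCo? _≟_ S Q

    Has : ℕ → ℕ → A → Set
    Has = Contains _≟_ S Q

    MinCoEnd : ℕ → Set
    MinCoEnd = IsMinCoEnd _≟_ S Q

    t : ℕ
    t = t₁ _≟_ S Q

    #co #lmco : ℕ → ℕ
    #co = co _≟_ S Q
    #lmco = lmco _≟_ S Q

  Has-mono : ∀ {i j i′ j′ q} → i′ ≤ i → j ≤ j′ → Has i j q → Has i′ j′ q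
  Has-mono i′≤i j≤j′ has with x , x∈ , Sx≡q ← find has =
    let i≤x , x≤j = ∈-range⁻ x∈ in lose (∈-range⁺ (≤-trans i′≤i i≤x) (≤-trans x≤j j≤j′)) Sx≡q

  Co-mono : ∀ {i j i′ j′} → 1 ≤ i′ → i′ ≤ i → j ≤ j′ → j′ ≤ length S → Co i j → Co i′ j′
  Co-mono 1≤i′ i′≤i j≤j′ j′≤n (_ , i≤j , _ , has) =
    1≤i′ , ≤-trans i′≤i (≤-trans i≤j j≤j′) , j′≤n , All.map (Has-mono i′≤i j≤j′) has

  Co-extendˡ : ∀ {i i′ j} → 1 ≤ i′ → i′ ≤ i → Co i j → Co i′ j
  Co-extendˡ 1≤i′ i′≤i c@(_ , _ , j≤n , _) = Co-mono 1≤i′ i′≤i ≤-refl j≤n c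

  Has-singleton : ∀ {j q} → Has j j q → charAt S j ≡ just q
  Has-singleton {q = q} has with x , x∈ , Sx≡q ← find has =
    let j≤x , x≤j = ∈-range⁻ x∈ in subst (λ k → charAt S k ≡ just q) (≤-antisym x≤j j≤x) Sx≡q

  ¬Co-singleton : Unique Q → 2 ≤ length Q → ∀ {j} → ¬ Co j j
  ¬Co-singleton uniq 2≤|Q| (_ , _ , _ , has) = distinct uniq 2≤|Q| has
    where
    distinct : ∀ {Q′ j} → Unique Q′ → 2 ≤ length Q′ → ¬ All (Has j j) Q′
    distinct {q ∷ q′ ∷ _} ((q≢q′ ∷ _) ∷ _) _ (has ∷ has′ ∷ _) =
      q≢q′ (just-injective (trans (sym (Has-singleton has)) (Has-singleton has′)))
    distinct {[]} _ ()
    distinct {_ ∷ []} _ (s≤s ())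

  ¬Co-empty : ∀ {j} → ¬ Co (suc j) j
  ¬Co-empty (_ , 1+j≤j , _) = 1+n≰n 1+j≤j

  ∃-leftMinimal : ∀ {i j} → Co i j → ∃[ i′ ] (Co i′ j × ¬ Co (suc i′) j)
  ∃-leftMinimal {i} {j} c@(_ , i≤j , _) =
    ∃-boundary (λ i′ → co? i′ j) (suc j ∸ i) c
               (¬Co-empty ∘ subst (λ i′ → Co i′ j) (m∸n+n≡m (m≤n⇒m≤1+n i≤j)))

  Co-prefix⇒MinCoEnd : ∀ {j} → Co 1 j → ¬ Co 1 (j ∸ 1) → MinCoEnd j
  Co-prefix⇒MinCoEnd {j} c ¬c′ with i , cᵢ@(1≤i , i≤j , _) , ¬cᵢ₊₁ ← ∃-leftMinimal c =
    lose (∈-range⁺ 1≤i i≤j) (cᵢ , ¬cᵢ₊₁ , ¬c′ ∘ Co-extendˡ ≤-refl 1≤i)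

  MinCoEnd⇒Co-prefix : ∀ {j} → MinCoEnd j → Co 1 j
  MinCoEnd⇒Co-prefix me with _ , _ , (c@(1≤i , _) , _) ← find me = Co-extendˡ ≤-refl 1≤i c

  Co-prefix⇒∃MinCoEnd : ∀ {j} → Co 1 j → ∃[ m ] (m ≤ j × MinCoEnd m)
  Co-prefix⇒∃MinCoEnd {zero} (_ , () , _)
  Co-prefix⇒∃MinCoEnd {suc j} c = case co? 1 j of λ where
    (yes c′) → let m , m≤j , me = Co-prefix⇒∃MinCoEnd c′ in m , m≤n⇒m≤1+n m≤j , me
    (no ¬c′) → suc j , ≤-refl , Co-prefix⇒MinCoEnd c ¬c′

  private
    first : List ℕ → ℕ
    first = firstOr _≟_ S Q (suc (length S))

  first-default-or-MinCoEnd : ∀ xs → first xs ≡ suc (length S) ⊎ MinCoEnd (first xs)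
  first-default-or-MinCoEnd [] = inj₁ refl
  first-default-or-MinCoEnd (x ∷ xs) with isMinCoEnd? _≟_ S Q x
  ... | yes me = inj₂ me
  ... | no _ = first-default-or-MinCoEnd xs

  first-≤ : ∀ {xs m} → AllPairs _<_ xs → m ∈ xs → MinCoEnd m → first xs ≤ m
  first-≤ {x ∷ xs} (x<xs ∷ _) m∈ me with isMinCoEnd? _≟_ S Q x
  first-≤ (x<xs ∷ _) (here refl) me | yes _ = ≤-refl
  first-≤ (x<xs ∷ _) (there m∈) me | yes _ = <⇒≤ (All.lookup x<xs m∈)
  first-≤ _ (here refl) me | no ¬me = contradiction me ¬me
  first-≤ (_ ∷ increasing) (there m∈) me | no _ = first-≤ increasing m∈ me

  Co-prefix⇒t₁≤ : ∀ {j} → Co 1 j → t ≤ j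
  Co-prefix⇒t₁≤ c with m , m≤j , me ← Co-prefix⇒∃MinCoEnd c =
    let _ , 1≤m , m≤n , _ = MinCoEnd⇒Co-prefix me in
    ≤-trans (first-≤ (range-increasing 1 (length S)) (∈-range⁺ 1≤m m≤n) me) m≤j

  t₁≤⇒Co-prefix : ∀ {j} → t ≤ j → j ≤ length S → Co 1 j
  t₁≤⇒Co-prefix {j} t≤j j≤n with first-default-or-MinCoEnd (range 1 (length S))
  ... | inj₁ t≡1+n = contradiction (subst (_≤ length S) t≡1+n (≤-trans t≤j j≤n)) 1+n≰n
  ... | inj₂ me = Co-mono ≤-refl ≤-refl t≤j j≤n (MinCoEnd⇒Co-prefix me)

  t₁-positive : 1 ≤ t
  t₁-positive = ≰⇒> λ t≤0 → ¬Co-empty (t₁≤⇒Co-prefix t≤0 z≤n)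

  #coAfter : ℕ → ℕ
  #coAfter w = count (λ k → co? (suc k ∸ w) k) (range (suc w) (length S))

  #co-suc : ∀ w → #co (suc w) ≡ #lmco (suc w) + #coAfter w
  #co-suc w = begin
    count Co? windows                                   ≡⟨ count-split Co? Co₊₁? (All.tabulate shorter⇒longer) ⟩
    #lmco (suc w) + count Co₊₁? windows                 ≡⟨ cong (#lmco (suc w) +_) (count-cong Co₊₁? _ (All.tabulate reindex)) ⟩
    #lmco (suc w) + #coAfter w                          ∎
    where
    windows = range (suc w) (length S)
    Co? : ∀ k → Dec (Co (k ∸ w) k)
    Co? k = co? (k ∸ w) k
    Co₊₁? : ∀ k → Dec (Co (suc (k ∸ w)) k)
    Co₊₁? k = co? (suc (k ∸ w)) k
    shorter⇒longer : ∀ {k} → k ∈ windows → Co (suc (k ∸ w)) k → Co (k ∸ w) k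
    shorter⇒longer k∈ = Co-extendˡ (m<n⇒0<n∸m (proj₁ (∈-range⁻ k∈))) (n≤1+n _)
    reindex : ∀ {k} → k ∈ windows → (Co (suc (k ∸ w)) k → Co (suc k ∸ w) k) × (Co (suc k ∸ w) k → Co (suc (k ∸ w)) k)
    reindex {k} k∈ = subst (λ i → Co i k) 1+k∸w≡ , subst (λ i → Co i k) (sym 1+k∸w≡)
      where 1+k∸w≡ = sym (+-∸-assoc 1 (<⇒≤ (proj₁ (∈-range⁻ k∈))))

  #co+excess≡#coAfter+excess : ∀ {w} → w ≤ length S → #co w + (w ∸ t) ≡ #coAfter w + (suc w ∸ t)
  #co+excess≡#coAfter+excess {w} w≤n = case co? 1 w of λ where
      (yes c) → begin
        #co w + (w ∸ t)                 ≡⟨ cong (_+ (w ∸ t)) (trans #co-head (count-accept Co? (from-prefix c))) ⟩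
        suc (#coAfter w) + (w ∸ t)      ≡⟨ +-suc (#coAfter w) (w ∸ t) ⟨
        #coAfter w + suc (w ∸ t)        ≡⟨ cong (#coAfter w +_) (+-∸-assoc 1 (Co-prefix⇒t₁≤ c)) ⟨
        #coAfter w + (suc w ∸ t)        ∎
      (no ¬c) →
        let w<t = ≰⇒> (¬c ∘ λ t≤w → t₁≤⇒Co-prefix t≤w w≤n) in
        cong₂ _+_ (trans #co-head (count-reject Co? (¬c ∘ to-prefix)))
                  (trans (m≤n⇒m∸n≡0 (<⇒≤ w<t)) (sym (m≤n⇒m∸n≡0 w<t)))
    where
    Co? : ∀ k → Dec (Co (suc k ∸ w) k)
    Co? k = co? (suc k ∸ w) k
    from-prefix : Co 1 w → Co (suc w ∸ w) w
    from-prefix = subst (λ i → Co i w) (sym (m+n∸n≡m 1 w))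
    to-prefix : Co (suc w ∸ w) w → Co 1 w
    to-prefix = subst (λ i → Co i w) (m+n∸n≡m 1 w)
    #co-head : #co w ≡ count Co? (w ∷ range (suc w) (length S))
    #co-head = cong (count Co?) (range-∷ w≤n)

  #co+excess≡Σ#lmco : Unique Q → 2 ≤ length Q → ∀ w → 1 ≤ w → w ≤ length S →
                      #co w + (w ∸ t) ≡ sum (map #lmco (range 2 w))
  #co+excess≡Σ#lmco uniq 2≤|Q| (suc zero) _ _ =
    cong₂ _+_ (count-none (λ k → co? k k) {range 1 (length S)} (All.tabulate λ _ → ¬Co-singleton uniq 2≤|Q|))
              (m≤n⇒m∸n≡0 t₁-positive)
  #co+excess≡Σ#lmco uniq 2≤|Q| (suc w@(suc _)) _ 1+w≤n = begin
    #co (suc w) + (suc w ∸ t)                         ≡⟨ cong (_+ (suc w ∸ t)) (#co-suc w) ⟩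
    #lmco (suc w) + #coAfter w + (suc w ∸ t)          ≡⟨ +-assoc (#lmco (suc w)) _ _ ⟩
    #lmco (suc w) + (#coAfter w + (suc w ∸ t))        ≡⟨ cong (#lmco (suc w) +_) (#co+excess≡#coAfter+excess w≤n) ⟨
    #lmco (suc w) + (#co w + (w ∸ t))                 ≡⟨ cong (#lmco (suc w) +_) (#co+excess≡Σ#lmco uniq 2≤|Q| w (s≤s z≤n) w≤n) ⟩
    #lmco (suc w) + sum (map #lmco (range 2 w))       ≡⟨ +-comm (#lmco (suc w)) _ ⟩
    sum (map #lmco (range 2 w)) + #lmco (suc w)       ≡⟨ sum-map-∷ʳ #lmco (range 2 w) (suc w) ⟨
    sum (map #lmco (range 2 w ∷ʳ suc w))              ≡⟨ cong (sum ∘ map #lmco) (range-∷ʳ {2} {w} (s≤s (s≤s z≤n))) ⟨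
    sum (map #lmco (range 2 (suc w)))                 ∎
    where w≤n = ≤-trans (n≤1+n w) 1+w≤n

open import Data.Integer using (+_; _-_; _⊖_)
open import Data.Integer.Properties using ([+m]-[+n]≡m⊖n; ⊖-≥)

m+n≡o⇒+m≡+o-+n : ∀ {m n o} → m + n ≡ o → + m ≡ + o - + n
m+n≡o⇒+m≡+o-+n {m} {n} refl = sym (begin
  + (m + n) - + n   ≡⟨ [+m]-[+n]≡m⊖n (m + n) n ⟩
  (m + n) ⊖ n       ≡⟨ ⊖-≥ (m≤n+m n m) ⟩
  + (m + n ∸ n)     ≡⟨ cong +_ (m+n∸n≡m m n) ⟩
  + m               ∎)

lemma4 : {A : Set} (_≟_ : DecidableEquality A) (S : List A) (Q : List A) →
    Unique Q → 2 ≤ length Q →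
    (w : ℕ) → 1 ≤ w → w ≤ length S →
    + co _≟_ S Q w
      ≡ + sum (map (lmco _≟_ S Q) (range 2 w)) - + (w ∸ t₁ _≟_ S Q)
lemma4 _≟_ S Q uniq 2≤|Q| w 1≤w w≤n = m+n≡o⇒+m≡+o-+n (#co+excess≡Σ#lmco _≟_ S Q uniq 2≤|Q| w 1≤w w≤n)
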